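{- Let $(x_i)_{i\in\mathbb{N}}$ be a sequence of rationals in $[0,1]$ and let $T(s,k)$ be the predicate $|s|<k\wedge\exists i\,(|s|<i\le k\wedge x_i\in I_s)$ for $s\in\mathbb{B}^\ast$, $k\in\mathbb{N}$. For $n\in\mathbb{N}$ and $p\colon\mathbb{N}\to\mathbb{N}$, there exists $i\le 2^n$ such that for all $s\in\mathbb{B}^n$, $T(s,p^{i+1}(0))\to T(s,p^i(0))$; define $\delta_n p:=p^i(0)$ for the least such $i$. Then for all $n$, all $p\colon\mathbb{N}\to\mathbb{N}$ and all $s\in\mathbb{B}^n$, $$T\big(s,p(\delta_n p)\big)\to T(s,\delta_n p).$$
   Context: $\mathbb{B}=\{0,1\}$, $\mathbb{B}^n$ boolean sequences of length $n$, $|s|$ length, $p^i$ the $i$-fold iterate of $p$ ($p^0$ the identity). For $|s|>0$, $I_s=\big[\sum_{i<|s|}s_i2^{ -(i+1)},\ \sum_{i<|s|}s_i2^{ -(i+1)}+2^{ -|s|}\big]$, and $I_{\langle\rangle}=[0,1]$. -}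

module Defs where

open import Data.Bool using (Bool; true; false)
open import Data.Nat as ℕ using (ℕ; zero; suc; _<_; _≤_; _^_)
import Data.Nat.Properties as ℕP
open import Data.Fin using (Fin; toℕ)
open import Data.Vec using (Vec; []; _∷_; lookup; tabulate; foldr; length)
open import Data.Rational using (ℚ; 0ℚ; 1ℚ; ½; _+_; _*_)
import Data.Rational.Properties as ℚP
open import Data.Product using (Σ; ∃; _×_; _,_)
open import Data.Sum using (_⊎_; inj₁; inj₂)
open import Relation.Nullary using (Dec; yes; no; ¬_)
open import Relation.Nullary.Decidable using (_×-dec_; _→-dec_)
import Data.Empty
import Relation.Binary.PropositionalEquality

iter : (ℕ → ℕ) → ℕ → ℕ → ℕ
iter p zero    x = x
iter p (suc i) x = p (iter p i x)

pow2inv : ℕ → ℚ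
pow2inv zero    = 1ℚ
pow2inv (suc k) = ½ * pow2inv k

bit : Bool → ℚ
bit true  = 1ℚ
bit false = 0ℚ

sumVec : ∀ {n} → Vec ℚ n → ℚ
sumVec = foldr _ _+_ 0ℚ

-- left endpoint of I_s : Σ_{i<|s|} s_i 2^{-(i+1)}
left : ∀ {n} → Vec Bool n → ℚ
left {n} s = sumVec (tabulate λ (i : Fin n) → bit (lookup s i) * pow2inv (suc (toℕ i)))

_∈I_ : ∀ {n} → ℚ → Vec Bool n → Set
_∈I_ {n} q s = left s Data.Rational.≤ q × q Data.Rational.≤ left s + pow2inv n

T : (ℕ → ℚ) → ∀ {n} → Vec Bool n → ℕ → Set
T x {n} s k = n < k × ∃ λ i → n < i × i ≤ k × x i ∈I s

-- decidability (needed to define δ as a least element)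

∈I? : ∀ {n} (q : ℚ) (s : Vec Bool n) → Dec (q ∈I s)
∈I? {n} q s = (left s ℚP.≤? q) ×-dec (q ℚP.≤? (left s + pow2inv n))

∃between? : (P : ℕ → Set) → (∀ i → Dec (P i)) → (m k : ℕ) →
            Dec (∃ λ i → m < i × i ≤ k × P i)
∃between? P P? m zero = no λ { (i , m<i , i≤0 , _) →
  ℕP.<-irrefl Relation.Binary.PropositionalEquality.refl (ℕP.<-≤-trans m<i (ℕP.≤-trans i≤0 ℕ.z≤n)) }
∃between? P P? m (suc k) with ∃between? P P? m k
... | yes (i , m<i , i≤k , pi) = yes (i , m<i , ℕP.m≤n⇒m≤1+n i≤k , pi)
... | no ¬r with m ℕP.<? suc k | P? (suc k)
...   | yes m<k1 | yes pk = yes (suc k , m<k1 , ℕP.≤-refl , pk)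
...   | yes m<k1 | no ¬pk = no λ { (i , m<i , i≤k1 , pi) → helper i m<i i≤k1 pi }
  where
  helper : ∀ i → m < i → i ≤ suc k → P i → Data.Empty.⊥
  helper i m<i i≤k1 pi with ℕP.m≤n⇒m<n∨m≡n i≤k1
  ... | inj₁ i<k1 = ¬r (i , m<i , ℕP.≤-pred i<k1 , pi)
  ... | inj₂ Relation.Binary.PropositionalEquality.refl = ¬pk pi
...   | no m≮k1 | _ = no λ { (i , m<i , i≤k1 , _) → m≮k1 (ℕP.<-≤-trans m<i i≤k1) }

T? : (x : ℕ → ℚ) → ∀ {n} (s : Vec Bool n) (k : ℕ) → Dec (T x s k)
T? x {n} s k = (n ℕP.<? k) ×-dec ∃between? (λ i → x i ∈I s) (λ i → ∈I? (x i) s) n k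

∀Vec? : ∀ n (Q : Vec Bool n → Set) → (∀ s → Dec (Q s)) → Dec (∀ s → Q s)
∀Vec? zero Q Q? with Q? []
... | yes q = yes λ { [] → q }
... | no ¬q = no λ f → ¬q (f [])
∀Vec? (suc n) Q Q? with ∀Vec? n (λ t → Q (true ∷ t)) (λ t → Q? (true ∷ t))
                      | ∀Vec? n (λ t → Q (false ∷ t)) (λ t → Q? (false ∷ t))
... | yes ft | yes ff = yes λ { (true ∷ t) → ft t ; (false ∷ t) → ff t }
... | no ¬ft | _ = no λ f → ¬ft (λ t → f (true ∷ t))
... | yes _  | no ¬ff = no λ f → ¬ff (λ t → f (false ∷ t))

Good : (ℕ → ℚ) → ℕ → (ℕ → ℕ) → ℕ → Set
Good x n p i = (s : Vec Bool n) → T x s (iter p (suc i) 0) → T x s (iter p i 0)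

Good? : (x : ℕ → ℚ) (n : ℕ) (p : ℕ → ℕ) (i : ℕ) → Dec (Good x n p i)
Good? x n p i = ∀Vec? n _ (λ s → T? x s (iter p (suc i) 0) →-dec T? x s (iter p i 0))

firstGood : (ℕ → ℚ) → ℕ → (ℕ → ℕ) → (fuel c : ℕ) → ℕ
firstGood x n p zero       c = c
firstGood x n p (suc fuel) c with Good? x n p c
... | yes _ = c
... | no  _ = firstGood x n p fuel (suc c)

-- least i ≤ 2^n with Good (returns 2^n if none of 0..2^n-1 is good;
-- the existence claim of the paper then says that 2^n is good)
leastGood : (ℕ → ℚ) → ℕ → (ℕ → ℕ) → ℕ
leastGood x n p = firstGood x n p (2 ^ n) 0

δ : (ℕ → ℚ) → ℕ → (ℕ → ℕ) → ℕ
δ x n p = iter p (leastGood x n p) 0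

-- Write k i = p^i(0) and S i = {s ∈ 𝔹ⁿ | T(s, k i)}; T(s, k) is monotone in k.
-- If k (i+1) ≤ k i then i is trivially good.  Otherwise S i ⊆ S (i+1), and i is
-- good exactly when this inclusion is an equality.  So while no index is good,
-- |S i| grows strictly with i, and the indices 0, …, 2ⁿ cannot all be bad:
-- otherwise |S (2ⁿ+1)| > 2ⁿ = |𝔹ⁿ|.  δ picks the least good index, so the second
-- claim is just goodness of that index.
module Submission where

open import Defs
open import Data.Bool using (Bool; true; false)
open import Data.Nat using (ℕ; zero; suc; _+_; _^_; _≤_; _<_; z≤n; s≤s)
open import Data.Nat.Properties
open import Data.Vec using (Vec; []; _∷_)
open import Data.Rational using (ℚ; 0ℚ; 1ℚ)
import Data.Rational as ℚ
open import Data.Product using (_×_; ∃; _,_)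
open import Data.Sum using (inj₁; inj₂)
open import Data.Empty using (⊥-elim)
open import Relation.Nullary using (yes; no; ¬_)
open import Level using (0ℓ)
open import Relation.Unary using (Pred; Decidable; _⊆′_)
open import Relation.Binary.PropositionalEquality using (_≡_; refl; sym; trans; subst)

count : ∀ n {P : Pred (Vec Bool n) 0ℓ} → Decidable P → ℕ
count zero    P? with P? []
... | yes _ = 1
... | no  _ = 0
count (suc n) P? = count n (λ t → P? (true ∷ t)) + count n (λ t → P? (false ∷ t))

count≤2^n : ∀ n {P : Pred (Vec Bool n) 0ℓ} (P? : Decidable P) → count n P? ≤ 2 ^ n
count≤2^n zero    P? with P? []
... | yes _ = s≤s z≤n
... | no  _ = z≤n
count≤2^n (suc n) P? =
  +-mono-≤ (count≤2^n n _) (≤-trans (count≤2^n n _) (m≤m+n (2 ^ n) 0))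

count-mono : ∀ n {P Q : Pred (Vec Bool n) 0ℓ} (P? : Decidable P) (Q? : Decidable Q) →
             P ⊆′ Q → count n P? ≤ count n Q?
count-mono zero    P? Q? P⊆Q with P? [] | Q? []
... | yes _ | yes _ = ≤-refl
... | yes p | no ¬q = ⊥-elim (¬q (P⊆Q [] p))
... | no  _ | _     = z≤n
count-mono (suc n) P? Q? P⊆Q =
  +-mono-≤ (count-mono n _ _ (λ t → P⊆Q (true ∷ t)))
           (count-mono n _ _ (λ t → P⊆Q (false ∷ t)))

count-⊆-≥⇒⊇ : ∀ n {P Q : Pred (Vec Bool n) 0ℓ} (P? : Decidable P) (Q? : Decidable Q) →
              P ⊆′ Q → count n Q? ≤ count n P? → Q ⊆′ P
count-⊆-≥⇒⊇ zero    P? Q? P⊆Q Q≤P with P? [] | Q? []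
... | yes p | _     = λ { [] _ → p }
... | no ¬p | yes _ with () ← Q≤P
... | no ¬p | no ¬q = λ { [] q → ⊥-elim (¬q q) }
count-⊆-≥⇒⊇ (suc n) P? Q? P⊆Q Q≤P
  = λ { (true  ∷ t) → count-⊆-≥⇒⊇ n _ _ (λ t → P⊆Q (true  ∷ t)) #Qᵗ≤#Pᵗ t
      ; (false ∷ t) → count-⊆-≥⇒⊇ n _ _ (λ t → P⊆Q (false ∷ t)) #Qᶠ≤#Pᶠ t }
  where
  #P #Q : Bool → ℕ
  #P b = count n (λ t → P? (b ∷ t))
  #Q b = count n (λ t → Q? (b ∷ t))

  #P≤#Q : ∀ b → #P b ≤ #Q b
  #P≤#Q b = count-mono n _ _ (λ t → P⊆Q (b ∷ t))

  #Qᵗ≤#Pᵗ : #Q true ≤ #P true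
  #Qᵗ≤#Pᵗ = +-cancelʳ-≤ _ _ _ (≤-trans Q≤P (+-monoʳ-≤ _ (#P≤#Q false)))

  #Qᶠ≤#Pᶠ : #Q false ≤ #P false
  #Qᶠ≤#Pᶠ = +-cancelˡ-≤ _ _ _ (≤-trans Q≤P (+-monoˡ-≤ _ (#P≤#Q true)))

count-⊂ : ∀ n {P Q : Pred (Vec Bool n) 0ℓ} (P? : Decidable P) (Q? : Decidable Q) →
          P ⊆′ Q → ¬ (Q ⊆′ P) → count n P? < count n Q?
count-⊂ n P? Q? P⊆Q Q⊈P = ≰⇒> (λ Q≤P → Q⊈P (count-⊆-≥⇒⊇ n P? Q? P⊆Q Q≤P))

T-mono : ∀ (x : ℕ → ℚ) {n} (s : Vec Bool n) {a b} → a ≤ b → T x s a → T x s b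
T-mono x s a≤b (n<a , i , n<i , i≤a , xᵢ∈Iₛ) =
  <-≤-trans n<a a≤b , i , n<i , ≤-trans i≤a a≤b , xᵢ∈Iₛ

module _ (x : ℕ → ℚ) (n : ℕ) (p : ℕ → ℕ) where

  private
    k : ℕ → ℕ
    k i = iter p i 0

    reached : ℕ → ℕ
    reached i = count n (λ s → T? x s (k i))

  bad-prefix≤reached : ∀ m → (∀ j → j < m → ¬ Good x n p j) → m ≤ reached m
  bad-prefix≤reached zero    _   = z≤n
  bad-prefix≤reached (suc m) bad with ≤-total (k (suc m)) (k m)
  ... | inj₁ kₘ₊₁≤kₘ = ⊥-elim (bad m ≤-refl (λ s → T-mono x s kₘ₊₁≤kₘ))
  ... | inj₂ kₘ≤kₘ₊₁ = ≤-<-trans (bad-prefix≤reached m (λ j j<m → bad j (m<n⇒m<1+n j<m)))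
                         (count-⊂ n _ _ (λ s → T-mono x s kₘ≤kₘ₊₁) (bad m ≤-refl))

  not-all-bad : ¬ (∀ j → j ≤ 2 ^ n → ¬ Good x n p j)
  not-all-bad bad = <-irrefl refl (≤-trans
    (bad-prefix≤reached (suc (2 ^ n)) (λ j j<1+2ⁿ → bad j (≤-pred j<1+2ⁿ)))
    (count≤2^n n _))

  firstGood-≤ : ∀ fuel c → firstGood x n p fuel c ≤ c + fuel
  firstGood-≤ zero       c = m≤m+n c 0
  firstGood-≤ (suc fuel) c with Good? x n p c
  ... | yes _ = m≤m+n c (suc fuel)
  ... | no  _ = ≤-trans (firstGood-≤ fuel (suc c)) (≤-reflexive (sym (+-suc c fuel)))

  firstGood-minimal : ∀ fuel c j → c ≤ j → j < firstGood x n p fuel c → ¬ Good x n p j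
  firstGood-minimal zero       c j c≤j j<c = ⊥-elim (<⇒≱ j<c c≤j)
  firstGood-minimal (suc fuel) c j c≤j j<r with Good? x n p c
  ... | yes _  = ⊥-elim (<⇒≱ j<r c≤j)
  ... | no ¬gc with m≤n⇒m<n∨m≡n c≤j
  ...   | inj₁ c<j  = firstGood-minimal fuel (suc c) j c<j j<r
  ...   | inj₂ refl = ¬gc

  firstGood-exhausted : ∀ fuel c → ¬ Good x n p (firstGood x n p fuel c) →
                        firstGood x n p fuel c ≡ c + fuel
  firstGood-exhausted zero       c _   = sym (+-identityʳ c)
  firstGood-exhausted (suc fuel) c ¬gr with Good? x n p c
  ... | yes gc = ⊥-elim (¬gr gc)
  ... | no  _  = trans (firstGood-exhausted fuel (suc c) ¬gr) (sym (+-suc c fuel))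

  leastGood-good : Good x n p (leastGood x n p)
  leastGood-good with Good? x n p (leastGood x n p)
  ... | yes g  = g
  ... | no ¬g  = ⊥-elim (not-all-bad bad)
    where
    leastGood≡2ⁿ : leastGood x n p ≡ 2 ^ n
    leastGood≡2ⁿ = firstGood-exhausted (2 ^ n) 0 ¬g

    bad : ∀ j → j ≤ 2 ^ n → ¬ Good x n p j
    bad j j≤2ⁿ with m≤n⇒m<n∨m≡n j≤2ⁿ
    ... | inj₁ j<2ⁿ = firstGood-minimal (2 ^ n) 0 j z≤n (subst (j <_) (sym leastGood≡2ⁿ) j<2ⁿ)
    ... | inj₂ refl = subst (λ i → ¬ Good x n p i) leastGood≡2ⁿ ¬g

lemma4p5 : (x : ℕ → ℚ) → (∀ i → 0ℚ ℚ.≤ x i × x i ℚ.≤ 1ℚ) →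
    ((n : ℕ) (p : ℕ → ℕ) → ∃ λ i → i Data.Nat.≤ 2 ^ n × Good x n p i)
    × ((n : ℕ) (p : ℕ → ℕ) (s : Vec Bool n) →
      T x s (p (δ x n p)) → T x s (δ x n p))
lemma4p5 x _ =
    (λ n p → leastGood x n p , firstGood-≤ x n p (2 ^ n) 0 , leastGood-good x n p)
  , (λ n p → leastGood-good x n p)
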